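{- Let $T(z)=\frac{1-\sqrt{1-4z}}{2}$. The bivariate generating function $S(z,t)$ of the class $\mathcal{S}$ of Catalan--Stanley trees, in which $t$ marks the rightmost leaves of the branches attached to the root and $z$ marks all other nodes, is \[ S(z,t) = z + \frac{zt}{1-t-T(z)^{2}}. \] In particular, there is exactly one Catalan--Stanley tree of size $1$, and for $n\ge 2$ the number of Catalan--Stanley trees of size $n$ (number of nodes) is the Catalan number $C_{n-2}=\frac{1}{n-1}\binom{2n-4}{n-2}$.
   Context: A rooted plane tree is a rooted tree in which the children of every node are linearly ordered. For a rooted plane tree $\tau$ whose root has children $c_1,\dots,c_k$, the "branch attached to the root" at $c_i$ is the subtree rooted at $c_i$, and its rightmost leaf is the leaf reached from $c_i$ by repeatedly moving to the last (rightmost) child. A Catalan--Stanley tree is a rooted plane tree in which, for each branch attached to the root, the distance from the root to the rightmost leaf of that branch is odd; the tree consisting of the root alone is also a Catalan--Stanley tree. $\mathcal{S}$ denotes the class of all Catalan--Stanley trees. $T(z)=\frac{1-\sqrt{1-4z}}{2}$ is the generating function of rooted plane trees by number of nodes and satisfies $T=z+T^2$. In $S(z,t)$, the coefficient of $z^a t^b$ counts Catalan--Stanley trees with $b$ such rightmost leaves (equivalently $b$ children of the root) and $a$ other nodes (the root included among the $z$-nodes). -}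

module Defs where

open import Data.Nat as ℕ using (ℕ; zero; suc)
open import Data.Integer as ℤ using (ℤ; +_; 0ℤ; 1ℤ)
open import Data.List using (List; []; _∷_)
import Data.List
open import Data.List.Relation.Unary.All using (All)
open import Data.Product using (Σ; _×_)
open import Relation.Binary.PropositionalEquality using (_≡_)

data Tree : Set where
  node : List Tree → Tree

mutual
  size : Tree → ℕ
  size (node cs) = suc (sizeL cs)

  sizeL : List Tree → ℕ
  sizeL []       = 0
  sizeL (c ∷ cs) = size c ℕ.+ sizeL cs

rootDegree : Tree → ℕ
rootDegree (node cs) = Data.List.length cs

mutual
  rdepth : Tree → ℕ
  rdepth (node [])       = 0
  rdepth (node (c ∷ cs)) = suc (rdepthLast c cs)

  rdepthLast : Tree → List Tree → ℕ
  rdepthLast c []       = rdepth c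
  rdepthLast c (d ∷ ds) = rdepthLast d ds

-- distance from the root of τ to the rightmost leaf of the branch
-- attached to the root at child c
branchDist : Tree → ℕ
branchDist c = suc (rdepth c)

Odd : ℕ → Set
Odd n = n ℕ.% 2 ≡ 1

IsCS : Tree → Set
IsCS (node cs) = All (λ c → Odd (branchDist c)) cs

-- Catalan--Stanley trees with b rightmost leaves of root branches
-- (= b children of the root) and a other nodes (root included)
CSab : ℕ → ℕ → Set
CSab a b = Σ Tree (λ τ → IsCS τ × (rootDegree τ ≡ b) × (size τ ≡ a ℕ.+ b))

CSn : ℕ → Set
CSn n = Σ Tree (λ τ → IsCS τ × (size τ ≡ n))

-- Formal power series in z, t with integer coefficients:
-- F a b is the coefficient of z^a t^b.

Series : Set
Series = ℕ → ℕ → ℤ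

_≈ₛ_ : Series → Series → Set
F ≈ₛ G = ∀ a b → F a b ≡ G a b

sumTo : ℕ → (ℕ → ℤ) → ℤ
sumTo zero    f = f 0
sumTo (suc n) f = sumTo n f ℤ.+ f (suc n)

_+ₛ_ : Series → Series → Series
(F +ₛ G) a b = F a b ℤ.+ G a b

_-ₛ_ : Series → Series → Series
(F -ₛ G) a b = F a b ℤ.- G a b

_·ₛ_ : ℤ → Series → Series
(k ·ₛ F) a b = k ℤ.* F a b

_*ₛ_ : Series → Series → Series
(F *ₛ G) a b = sumTo a (λ i → sumTo b (λ j → F i j ℤ.* G (a ℕ.∸ i) (b ℕ.∸ j)))

oneₛ : Series
oneₛ zero zero = 1ℤ
oneₛ _    _    = 0ℤ

zₛ : Series
zₛ (suc zero) zero = 1ℤ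
zₛ _          _    = 0ℤ

tₛ : Series
tₛ zero (suc zero) = 1ℤ
tₛ _    _          = 0ℤ

liftZ : (ℕ → ℤ) → Series
liftZ f a zero    = f a
liftZ f a (suc b) = 0ℤ

fromℕ : (ℕ → ℕ → ℕ) → Series
fromℕ S a b = + (S a b)

-- Analytic part.  (1 - 2T)² = 1 - 4z gives T = z + T², hence also T = z + zT + T³.
-- Multiplying the derivative identity (1 - 2T)·zT' = z by (1 - 2T) gives
-- (1 - 4z)·zT' = (1 - 2T)·z, i.e. (n+2)·T(n+2) = (4n+2)·T(n+1), and by comparison with the
-- recurrence of central binomial coefficients, (n+1)·T(n+1) = C(2n, n).
--
-- Plane trees with n nodes are counted by T(n) (first-child
-- decomposition).  A branch of a Catalan--Stanley tree is a tree whose rightmost path has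
-- even length; cutting the last two edges of that path shows that a branch is a leaf or a
-- pair of trees grafted onto a shorter branch.  A Catalan--Stanley tree is a root with a
-- sequence of branches, and nonempty sequences of branches X satisfy X = z + zX + T²X, the
-- equation solved by T; so there are [zᵐ](1 + T) Catalan--Stanley trees with m + 1 nodes.
-- Keeping track of the number b of branches gives the recurrence
-- S(a+1, b+1) = S(a+1, b) + Σ_j [zʲ]T² · S(a-j+1, b+1), which is the coefficient form of
-- (S - z)(1 - t - T²) = z t.
module Submission where

open import Data.Nat as ℕ using (ℕ)
open import Data.Integer as ℤ using (ℤ; 0ℤ)
open import Relation.Binary.PropositionalEquality using (_≡_)

module Convolution where

  open import Data.Nat as ℕ using (ℕ; zero; suc; _∸_; _≤_; z≤n; s≤s)
  import Data.Nat.Properties as ℕ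
  open import Data.Integer using (ℤ; +_; 0ℤ; 1ℤ; -1ℤ; _+_; _*_; -_; _-_)
  open import Data.Integer.Properties
  open import Data.Integer.Tactic.RingSolver using (solve-∀)
  open import Function using (_∘_)
  open import Relation.Nullary using (¬_; yes; no)
  open import Data.Empty using (⊥-elim)
  open import Relation.Binary.PropositionalEquality hiding ([_])
  open ≡-Reasoning

  open import Defs using (sumTo)

  private variable
    f g h : ℕ → ℤ
    n : ℕ

  sumTo-cong : ∀ n → (∀ i → i ≤ n → f i ≡ g i) → sumTo n f ≡ sumTo n g
  sumTo-cong zero    eq = eq 0 z≤n
  sumTo-cong (suc n) eq = cong₂ _+_ (sumTo-cong n (λ i i≤n → eq i (ℕ.m≤n⇒m≤1+n i≤n))) (eq (suc n) ℕ.≤-refl)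

  sumTo-zero : ∀ n → (∀ i → i ≤ n → f i ≡ 0ℤ) → sumTo n f ≡ 0ℤ
  sumTo-zero zero    eq = eq 0 z≤n
  sumTo-zero (suc n) eq = cong₂ _+_ (sumTo-zero n (λ i i≤n → eq i (ℕ.m≤n⇒m≤1+n i≤n))) (eq (suc n) ℕ.≤-refl)

  sumTo-single : ∀ n k → k ≤ n → (∀ i → i ≤ n → ¬ i ≡ k → f i ≡ 0ℤ) → sumTo n f ≡ f k
  sumTo-single zero .zero z≤n _ = refl
  sumTo-single {f} (suc n) k k≤1+n zeros with k ℕ.≟ suc n
  ... | yes refl = begin
      sumTo n f + f (suc n) ≡⟨ cong (_+ f (suc n)) (sumTo-zero n (λ i i≤n → zeros i (ℕ.m≤n⇒m≤1+n i≤n) (ℕ.<⇒≢ (s≤s i≤n)))) ⟩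
      0ℤ + f (suc n)        ≡⟨ +-identityˡ _ ⟩
      f (suc n)             ∎
  ... | no k≢1+n = begin
      sumTo n f + f (suc n) ≡⟨ cong₂ _+_ (sumTo-single n k k≤n (λ i i≤n → zeros i (ℕ.m≤n⇒m≤1+n i≤n))) (zeros (suc n) ℕ.≤-refl (k≢1+n ∘ sym)) ⟩
      f k + 0ℤ              ≡⟨ +-identityʳ _ ⟩
      f k                   ∎
    where k≤n = ℕ.≤-pred (ℕ.≤∧≢⇒< k≤1+n k≢1+n)

  sumTo-shift : ∀ n (f : ℕ → ℤ) → sumTo (suc n) f ≡ f 0 + sumTo n (f ∘ suc)
  sumTo-shift zero    f = refl
  sumTo-shift (suc n) f = trans (cong (_+ f (suc (suc n))) (sumTo-shift n f)) (+-assoc (f 0) _ _)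

  sumTo-+ : ∀ n (f g : ℕ → ℤ) → sumTo n (λ i → f i + g i) ≡ sumTo n f + sumTo n g
  sumTo-+ zero    f g = refl
  sumTo-+ (suc n) f g = trans (cong (_+ (f (suc n) + g (suc n))) (sumTo-+ n f g)) (swap-middle (sumTo n f) (sumTo n g) (f (suc n)) (g (suc n)))
    where
    swap-middle : ∀ a b c d → (a + b) + (c + d) ≡ (a + c) + (b + d)
    swap-middle = solve-∀

  sumTo-*ˡ : ∀ n (k : ℤ) (f : ℕ → ℤ) → k * sumTo n f ≡ sumTo n (λ i → k * f i)
  sumTo-*ˡ zero    k f = refl
  sumTo-*ˡ (suc n) k f = trans (*-distribˡ-+ k (sumTo n f) (f (suc n))) (cong (_+ k * f (suc n)) (sumTo-*ˡ n k f))

  sumTo-*ʳ : ∀ n (f : ℕ → ℤ) (k : ℤ) → sumTo n f * k ≡ sumTo n (λ i → f i * k)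
  sumTo-*ʳ n f k = trans (*-comm _ k) (trans (sumTo-*ˡ n k f) (sumTo-cong n (λ i _ → *-comm k (f i))))

  sumTo-reverse : ∀ n (f : ℕ → ℤ) → sumTo n f ≡ sumTo n (λ i → f (n ∸ i))
  sumTo-reverse zero    f = refl
  sumTo-reverse (suc n) f = begin
    sumTo n f + f (suc n)                  ≡⟨ +-comm (sumTo n f) (f (suc n)) ⟩
    f (suc n) + sumTo n f                  ≡⟨ cong (λ x → f (suc n) + x) (sumTo-reverse n f) ⟩
    f (suc n) + sumTo n (λ i → f (n ∸ i))  ≡⟨ sym (sumTo-shift n (λ i → f (suc n ∸ i))) ⟩
    sumTo (suc n) (λ i → f (suc n ∸ i))    ∎

  private
    suc-∸ : ∀ {n i} → i ≤ n → suc n ∸ i ≡ suc (n ∸ i)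
    suc-∸ = ℕ.+-∸-assoc 1

  -- Σ_{i ≤ n} Σ_{j ≤ n-i} g i j = Σ_{k ≤ n} Σ_{i ≤ k} g i (k-i): both run over i + j ≤ n.
  sumTo-triangle : ∀ n (g : ℕ → ℕ → ℤ) → sumTo n (λ i → sumTo (n ∸ i) (g i)) ≡ sumTo n (λ k → sumTo k (λ i → g i (k ∸ i)))
  sumTo-triangle zero    g = refl
  sumTo-triangle (suc n) g = begin
      sumTo n (λ i → sumTo (suc n ∸ i) (g i)) + sumTo (n ∸ n) (g (suc n))
    ≡⟨ cong₂ _+_ (sumTo-cong n (λ i i≤n → cong (λ x → sumTo x (g i)) (suc-∸ i≤n))) (cong (λ x → sumTo x (g (suc n))) (ℕ.n∸n≡0 n)) ⟩
      sumTo n (λ i → sumTo (n ∸ i) (g i) + g i (suc (n ∸ i))) + g (suc n) 0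
    ≡⟨ cong (_+ g (suc n) 0) (sumTo-+ n _ _) ⟩
      (inner + diagonal) + g (suc n) 0
    ≡⟨ +-assoc inner diagonal (g (suc n) 0) ⟩
      inner + (diagonal + g (suc n) 0)
    ≡⟨ cong₂ _+_ (sumTo-triangle n g) (cong₂ _+_ (sumTo-cong n (λ i i≤n → cong (g i) (sym (suc-∸ i≤n)))) (cong (g (suc n)) (sym (ℕ.n∸n≡0 n)))) ⟩
      sumTo n (λ k → sumTo k (λ i → g i (k ∸ i))) + sumTo (suc n) (λ i → g i (suc n ∸ i))
    ∎
    where
    inner    = sumTo n (λ i → sumTo (n ∸ i) (g i))
    diagonal = sumTo n (λ i → g i (suc (n ∸ i)))

  -- The Kronecker delta: δ k is the coefficient sequence of the monomial z^k.
  δ : ℕ → ℕ → ℤ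
  δ zero    zero    = 1ℤ
  δ zero    (suc n) = 0ℤ
  δ (suc k) zero    = 0ℤ
  δ (suc k) (suc n) = δ k n

  conv : (ℕ → ℤ) → (ℕ → ℤ) → ℕ → ℤ
  conv f g n = sumTo n (λ i → f i * g (n ∸ i))

  conv-congˡ : ∀ h → (∀ i → f i ≡ g i) → ∀ n → conv f h n ≡ conv g h n
  conv-congˡ h eq n = sumTo-cong n (λ i _ → cong (_* h (n ∸ i)) (eq i))

  conv-comm : ∀ f g n → conv f g n ≡ conv g f n
  conv-comm f g n = trans (sumTo-reverse n _) (sumTo-cong n (λ i i≤n →
    trans (*-comm (f (n ∸ i)) _) (cong (λ k → g k * f (n ∸ i)) (ℕ.m∸[m∸n]≡n i≤n))))

  conv-assoc : ∀ f g h n → conv f (conv g h) n ≡ conv (conv f g) h n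
  conv-assoc f g h n = begin
      sumTo n (λ i → f i * sumTo (n ∸ i) (λ j → g j * h ((n ∸ i) ∸ j)))
    ≡⟨ sumTo-cong n (λ i _ → sumTo-*ˡ (n ∸ i) (f i) _) ⟩
      sumTo n (λ i → sumTo (n ∸ i) (λ j → f i * (g j * h ((n ∸ i) ∸ j))))
    ≡⟨ sumTo-triangle n (λ i j → f i * (g j * h ((n ∸ i) ∸ j))) ⟩
      sumTo n (λ k → sumTo k (λ i → f i * (g (k ∸ i) * h ((n ∸ i) ∸ (k ∸ i)))))
    ≡⟨ sumTo-cong n (λ k k≤n → trans (sumTo-cong k (λ i i≤k → reassociate i≤k k≤n)) (sym (sumTo-*ʳ k _ (h (n ∸ k))))) ⟩
      sumTo n (λ k → conv f g k * h (n ∸ k))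
    ∎
    where
    reassociate : ∀ {i k} → i ≤ k → k ≤ n → f i * (g (k ∸ i) * h ((n ∸ i) ∸ (k ∸ i))) ≡ f i * g (k ∸ i) * h (n ∸ k)
    reassociate {i} {k} i≤k k≤n = trans (sym (*-assoc (f i) _ _))
      (cong (λ x → f i * g (k ∸ i) * h x) (trans (ℕ.∸-+-assoc n i (k ∸ i)) (cong (n ∸_) (ℕ.m+[n∸m]≡n i≤k))))

  conv-+ˡ : ∀ f g h n → conv (λ i → f i + g i) h n ≡ conv f h n + conv g h n
  conv-+ˡ f g h n = trans (sumTo-cong n (λ i _ → *-distribʳ-+ (h (n ∸ i)) (f i) (g i))) (sumTo-+ n _ _)

  conv-*ˡ : ∀ k f h n → conv (λ i → k * f i) h n ≡ k * conv f h n
  conv-*ˡ k f h n = trans (sumTo-cong n (λ i _ → *-assoc k (f i) (h (n ∸ i)))) (sym (sumTo-*ˡ n k _))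

  conv-linear : ∀ f c g h n → conv (λ i → f i - c * g i) h n ≡ conv f h n - c * conv g h n
  conv-linear f c g h n = begin
    conv (λ i → f i - c * g i) h n               ≡⟨ conv-+ˡ f (λ i → - (c * g i)) h n ⟩
    conv f h n + conv (λ i → - (c * g i)) h n    ≡⟨ cong (λ x → conv f h n + x) (conv-congˡ h (λ i → neg-distribˡ-* c (g i)) n) ⟩
    conv f h n + conv (λ i → - c * g i) h n      ≡⟨ cong (λ x → conv f h n + x) (conv-*ˡ (- c) g h n) ⟩
    conv f h n + - c * conv g h n                ≡⟨ cong (λ x → conv f h n + x) (sym (neg-distribˡ-* c _)) ⟩
    conv f h n - c * conv g h n                  ∎

  conv-zeroˡ : ∀ g → (∀ i → f i ≡ 0ℤ) → ∀ n → conv f g n ≡ 0ℤ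
  conv-zeroˡ g f≡0 n = sumTo-zero n (λ i _ → trans (cong (_* g (n ∸ i)) (f≡0 i)) (*-zeroˡ (g (n ∸ i))))

  conv-congʳ : ∀ f → (∀ i → g i ≡ h i) → ∀ n → conv f g n ≡ conv f h n
  conv-congʳ f eq n = sumTo-cong n (λ i _ → cong (f i *_) (eq (n ∸ i)))

  conv-zeroʳ : ∀ f → (∀ i → g i ≡ 0ℤ) → ∀ n → conv f g n ≡ 0ℤ
  conv-zeroʳ {g} f g≡0 n = trans (conv-comm f g n) (conv-zeroˡ f g≡0 n)

  conv-+ʳ : ∀ f g h n → conv f (λ i → g i + h i) n ≡ conv f g n + conv f h n
  conv-+ʳ f g h n = begin
    conv f (λ i → g i + h i) n  ≡⟨ conv-comm f (λ i → g i + h i) n ⟩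
    conv (λ i → g i + h i) f n  ≡⟨ conv-+ˡ g h f n ⟩
    conv g f n + conv h f n     ≡⟨ cong₂ _+_ (conv-comm g f n) (conv-comm h f n) ⟩
    conv f g n + conv f h n     ∎

  conv-negʳ : ∀ f g n → conv f (λ i → - g i) n ≡ - conv f g n
  conv-negʳ f g n = begin
    conv f (λ i → - g i) n       ≡⟨ conv-congʳ f (λ i → sym (-1*i≡-i (g i))) n ⟩
    conv f (λ i → -1ℤ * g i) n   ≡⟨ conv-comm f (λ i → -1ℤ * g i) n ⟩
    conv (λ i → -1ℤ * g i) f n   ≡⟨ conv-*ˡ -1ℤ g f n ⟩
    -1ℤ * conv g f n             ≡⟨ -1*i≡-i _ ⟩
    - conv g f n                 ≡⟨ cong -_ (conv-comm g f n) ⟩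
    - conv f g n                 ∎

  conv-oneˡ : ∀ f n → conv (δ 0) f n ≡ f n
  conv-oneˡ f n = trans (sumTo-single n 0 z≤n (λ { zero _ 0≢0 → ⊥-elim (0≢0 refl) ; (suc i) _ _ → *-zeroˡ (f (n ∸ suc i)) })) (*-identityˡ (f n))

  conv-oneʳ : ∀ f n → conv f (δ 0) n ≡ f n
  conv-oneʳ f n = trans (conv-comm f (δ 0) n) (conv-oneˡ f n)

  conv-suc : ∀ f g n → conv f g (suc n) ≡ f 0 * g (suc n) + conv (f ∘ suc) g n
  conv-suc f g n = sumTo-shift n _

  conv-zˡ : ∀ f n → conv (δ 1) f (suc n) ≡ f n
  conv-zˡ f n = trans (conv-suc (δ 1) f n) (trans (cong (_+ conv (δ 0) f n) (*-zeroˡ (f (suc n)))) (trans (+-identityˡ _) (conv-oneˡ f n)))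

  -- Leibniz rule for the derivative-like operator f ↦ (n ↦ n · f n).
  conv-leibniz : ∀ f g n → + n * conv f g n ≡ conv (λ i → + i * f i) g n + conv f (λ i → + i * g i) n
  conv-leibniz f g n = begin
      + n * sumTo n (λ i → f i * g (n ∸ i))
    ≡⟨ sumTo-*ˡ n (+ n) _ ⟩
      sumTo n (λ i → + n * (f i * g (n ∸ i)))
    ≡⟨ sumTo-cong n (λ i i≤n → trans (cong (λ k → k * (f i * g (n ∸ i))) (split i≤n)) (distribute (+ i) (+ (n ∸ i)) (f i) (g (n ∸ i)))) ⟩
      sumTo n (λ i → (+ i * f i) * g (n ∸ i) + f i * (+ (n ∸ i) * g (n ∸ i)))
    ≡⟨ sumTo-+ n _ _ ⟩
      conv (λ i → + i * f i) g n + conv f (λ i → + i * g i) n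
    ∎
    where
    split : ∀ {i} → i ≤ n → + n ≡ + i + + (n ∸ i)
    split {i} i≤n = trans (cong +_ (sym (ℕ.m+[n∸m]≡n i≤n))) (pos-+ i (n ∸ i))
    distribute : ∀ a b x y → (a + b) * (x * y) ≡ (a * x) * y + x * (b * y)
    distribute = solve-∀


module CentralBinomial where

  open import Data.Nat
  open import Data.Nat.Properties
  open import Data.Nat.Combinatorics using (_C_; nCk≡n!/k![n-k]!; k![n∸k]!∣n!)
  open import Data.Nat.DivMod using (m/n*n≡m)
  open import Data.Nat.Tactic.RingSolver using (solve-∀)
  open import Relation.Binary.PropositionalEquality hiding ([_])

  central : ℕ → ℕ
  central m = (2 * m) C m

  binomial-factorial : ∀ n k → k ≤ n → (n C k) * (k ! * (n ∸ k) !) ≡ n !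
  binomial-factorial n k k≤n = trans (cong (_* (k ! * (n ∸ k) !)) (nCk≡n!/k![n-k]! k≤n))
                                     (m/n*n≡m {{k !* (n ∸ k) !≢0}} (k![n∸k]!∣n! k≤n))

  central-factorial : ∀ m → central m * (m ! * m !) ≡ (2 * m) !
  central-factorial m = trans (cong (λ k → central m * (m ! * k !)) (sym 2m∸m≡m)) (binomial-factorial (2 * m) m m≤2m)
    where
    2m≡m+m : 2 * m ≡ m + m
    2m≡m+m = cong (λ k → m + k) (+-identityʳ m)
    2m∸m≡m : 2 * m ∸ m ≡ m
    2m∸m≡m = trans (cong (_∸ m) 2m≡m+m) (m+n∸m≡n m m)
    m≤2m : m ≤ 2 * m
    m≤2m = subst (m ≤_) (sym 2m≡m+m) (m≤m+n m m)

  central-rec : ∀ m → suc m * central (suc m) ≡ (4 * m + 2) * central m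
  central-rec m = *-cancelʳ-≡ _ _ (suc m * (m ! * m !)) {{m*n≢0 (suc m) (m ! * m !) {{_}} {{m !* m !≢0}}}} (begin
      suc m * central (suc m) * (suc m * (m ! * m !))
    ≡⟨ regroup m (central (suc m)) (m !) ⟩
      central (suc m) * ((suc m * m !) * (suc m * m !))
    ≡⟨ central-factorial (suc m) ⟩
      (2 * suc m) !
    ≡⟨ cong _! (*-suc 2 m) ⟩
      (2 + 2 * m) * ((1 + 2 * m) * (2 * m) !)
    ≡⟨ cong (λ k → (2 + 2 * m) * ((1 + 2 * m) * k)) (sym (central-factorial m)) ⟩
      (2 + 2 * m) * ((1 + 2 * m) * (central m * (m ! * m !)))
    ≡⟨ expand m (central m) (m !) ⟩
      (4 * m + 2) * central m * (suc m * (m ! * m !))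
    ∎)
    where
    open ≡-Reasoning
    regroup : ∀ a x f → suc a * x * (suc a * (f * f)) ≡ x * ((suc a * f) * (suc a * f))
    regroup = solve-∀
    expand : ∀ a x f → (2 + 2 * a) * ((1 + 2 * a) * (x * (f * f))) ≡ (4 * a + 2) * x * (suc a * (f * f))
    expand = solve-∀


open Convolution using (δ; conv)

module SquareRootSeries
  (T : ℕ → ℤ) (T0 : T 0 ≡ 0ℤ)
  (square : ∀ n → conv (λ i → δ 0 i ℤ.- ℤ.+ 2 ℤ.* T i) (λ i → δ 0 i ℤ.- ℤ.+ 2 ℤ.* T i) n ≡ δ 0 n ℤ.- ℤ.+ 4 ℤ.* δ 1 n)
  where

  open import Data.Nat as ℕ using (ℕ; zero; suc)
  open import Data.Integer using (ℤ; +_; 0ℤ; 1ℤ; _+_; _*_; _-_)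
  open import Data.Integer.Properties
  open import Data.Integer.Tactic.RingSolver using (solve-∀)
  open import Relation.Binary.PropositionalEquality hiding ([_])
  open ≡-Reasoning
  open Convolution
  open CentralBinomial using (central; central-rec)

  R : ℕ → ℤ
  R i = δ 0 i - + 2 * T i

  square-expanded : ∀ n → conv R R n ≡ (δ 0 n - + 2 * T n) - + 2 * (T n - + 2 * conv T T n)
  square-expanded n = begin
      conv R R n
    ≡⟨ conv-linear (δ 0) (+ 2) T R n ⟩
      conv (δ 0) R n - + 2 * conv T R n
    ≡⟨ cong₂ (λ x y → x - + 2 * y) (conv-oneˡ R n) (conv-comm T R n) ⟩
      R n - + 2 * conv R T n
    ≡⟨ cong (λ x → R n - + 2 * x) (trans (conv-linear (δ 0) (+ 2) T T n) (cong (_- + 2 * conv T T n) (conv-oneˡ T n))) ⟩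
      (δ 0 n - + 2 * T n) - + 2 * (T n - + 2 * conv T T n)
    ∎

  T-rec : ∀ n → T n ≡ δ 1 n + conv T T n
  T-rec n = *-cancelˡ-≡ (+ 4) (T n) (δ 1 n + conv T T n) (solve-for-T (δ 0 n) (T n) (conv T T n) (δ 1 n) (trans (sym (square-expanded n)) (square n)))
    where
    solve-for-T : ∀ a t q z → (a - + 2 * t) - + 2 * (t - + 2 * q) ≡ a - + 4 * z → + 4 * t ≡ + 4 * (z + q)
    solve-for-T a t q z eq = begin
        + 4 * t                                                  ≡⟨ isolate a t q ⟩
        (a + + 4 * q) - ((a - + 2 * t) - + 2 * (t - + 2 * q))    ≡⟨ cong (λ x → (a + + 4 * q) - x) eq ⟩
        (a + + 4 * q) - (a - + 4 * z)                            ≡⟨ collect a q z ⟩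
        + 4 * (z + q)                                            ∎
      where
      isolate : ∀ a t q → + 4 * t ≡ (a + + 4 * q) - ((a - + 2 * t) - + 2 * (t - + 2 * q))
      isolate = solve-∀
      collect : ∀ a q z → (a + + 4 * q) - (a - + 4 * z) ≡ + 4 * (z + q)
      collect = solve-∀

  T1 : T 1 ≡ 1ℤ
  T1 = begin
    T 1                          ≡⟨ T-rec 1 ⟩
    1ℤ + (T 0 * T 1 + T 1 * T 0) ≡⟨ cong (λ x → 1ℤ + (x * T 1 + T 1 * x)) T0 ⟩
    1ℤ + (0ℤ * T 1 + T 1 * 0ℤ)   ≡⟨ simplify (T 1) ⟩
    1ℤ                           ∎
    where
    simplify : ∀ x → 1ℤ + (0ℤ * x + x * 0ℤ) ≡ 1ℤ
    simplify = solve-∀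

  -- T = z + zT + T³, the identity behind the count of forests of branches.
  T-cubic : ∀ m → T (suc m) ≡ (δ 0 m + T m) + conv (conv T T) T (suc m)
  T-cubic m = sym (begin
      (δ 0 m + T m) + conv (conv T T) T (suc m)
    ≡⟨ cong (λ x → (δ 0 m + T m) + x) (conv-congˡ T T²≡T-z (suc m)) ⟩
      (δ 0 m + T m) + conv (λ i → T i - 1ℤ * δ 1 i) T (suc m)
    ≡⟨ cong (λ x → (δ 0 m + T m) + x) (conv-linear T 1ℤ (δ 1) T (suc m)) ⟩
      (δ 0 m + T m) + (conv T T (suc m) - 1ℤ * conv (δ 1) T (suc m))
    ≡⟨ cong₂ (λ x y → (δ 0 m + T m) + (x - 1ℤ * y)) (T²≡T-z (suc m)) (conv-zˡ T m) ⟩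
      (δ 0 m + T m) + ((T (suc m) - 1ℤ * δ 0 m) - 1ℤ * T m)
    ≡⟨ cancel (δ 0 m) (T m) (T (suc m)) ⟩
      T (suc m)
    ∎)
    where
    T²≡T-z : ∀ i → conv T T i ≡ T i - 1ℤ * δ 1 i
    T²≡T-z i = trans (isolate (δ 1 i) (conv T T i)) (cong (_- 1ℤ * δ 1 i) (sym (T-rec i)))
      where
      isolate : ∀ z q → q ≡ (z + q) - 1ℤ * z
      isolate = solve-∀
    cancel : ∀ d t u → (d + t) + ((u - 1ℤ * d) - 1ℤ * t) ≡ u
    cancel = solve-∀

  -- The derivative-like series D = z T', with coefficients n · T n.
  D : ℕ → ℤ
  D i = + i * T i

  -- (1 - 2T) · z T' = z, the derivative of T = z + T² rearranged.
  R·D≡z : ∀ n → conv R D n ≡ δ 1 n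
  R·D≡z n = begin
      conv R D n
    ≡⟨ conv-linear (δ 0) (+ 2) T D n ⟩
      conv (δ 0) D n - + 2 * conv T D n
    ≡⟨ cong₂ (λ x y → x - y) (conv-oneˡ D n) (sym twice-T·D) ⟩
      + n * T n - + n * conv T T n
    ≡⟨ cong (λ x → + n * x - + n * conv T T n) (T-rec n) ⟩
      + n * (δ 1 n + conv T T n) - + n * conv T T n
    ≡⟨ cancel (+ n) (δ 1 n) (conv T T n) ⟩
      + n * δ 1 n
    ≡⟨ n·δ1 n ⟩
      δ 1 n
    ∎
    where
    twice-T·D : + n * conv T T n ≡ + 2 * conv T D n
    twice-T·D = trans (conv-leibniz T T n) (trans (cong (_+ conv T D n) (conv-comm D T n)) (double (conv T D n)))
      where
      double : ∀ x → x + x ≡ + 2 * x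
      double = solve-∀
    cancel : ∀ a d q → a * (d + q) - a * q ≡ a * d
    cancel = solve-∀
    n·δ1 : ∀ n → + n * δ 1 n ≡ δ 1 n
    n·δ1 zero          = refl
    n·δ1 (suc zero)    = refl
    n·δ1 (suc (suc n)) = *-zeroʳ (+ suc (suc n))

  -- Multiplying by (1 - 2T)² = 1 - 4z:  (1 - 4z) · zT' = (1 - 2T) · z, read at zᵐ⁺¹.
  D-rec : ∀ m → D (suc m) - + 4 * D m ≡ R m
  D-rec m = begin
      D (suc m) - + 4 * D m
    ≡⟨ cong₂ (λ x y → x - + 4 * y) (sym (conv-oneˡ D (suc m))) (sym (conv-zˡ D m)) ⟩
      conv (δ 0) D (suc m) - + 4 * conv (δ 1) D (suc m)
    ≡⟨ sym (conv-linear (δ 0) (+ 4) (δ 1) D (suc m)) ⟩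
      conv (λ i → δ 0 i - + 4 * δ 1 i) D (suc m)
    ≡⟨ conv-congˡ D (λ i → sym (square i)) (suc m) ⟩
      conv (conv R R) D (suc m)
    ≡⟨ sym (conv-assoc R R D (suc m)) ⟩
      conv R (conv R D) (suc m)
    ≡⟨ conv-congʳ R R·D≡z (suc m) ⟩
      conv R (δ 1) (suc m)
    ≡⟨ trans (conv-comm R (δ 1) (suc m)) (conv-zˡ R m) ⟩
      R m
    ∎

  -- D-rec at m + 1, where R(m + 1) = -2 T(m + 1):  (m+2)·T(m+2) = (4m+2)·T(m+1).
  T-step : ∀ m → + suc (suc m) * T (suc (suc m)) ≡ + (4 ℕ.* m ℕ.+ 2) * T (suc m)
  T-step m = begin
      + suc (suc m) * T (suc (suc m))
    ≡⟨ rearrange (D (suc (suc m))) (D (suc m)) (T (suc m)) (D-rec (suc m)) ⟩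
      + 4 * (+ suc m * T (suc m)) - + 2 * T (suc m)
    ≡⟨ cong (λ k → + 4 * (k * T (suc m)) - + 2 * T (suc m)) (pos-+ 1 m) ⟩
      + 4 * ((1ℤ + + m) * T (suc m)) - + 2 * T (suc m)
    ≡⟨ collect (+ m) (T (suc m)) ⟩
      (+ 4 * + m + + 2) * T (suc m)
    ≡⟨ cong (_* T (suc m)) (sym (trans (pos-+ (4 ℕ.* m) 2) (cong (_+ + 2) (pos-* 4 m)))) ⟩
      + (4 ℕ.* m ℕ.+ 2) * T (suc m)
    ∎
    where
    rearrange : ∀ d₂ d₁ t → d₂ - + 4 * d₁ ≡ 0ℤ - + 2 * t → d₂ ≡ + 4 * d₁ - + 2 * t
    rearrange d₂ d₁ t eq = trans (trans (add-back d₂ d₁) (cong (_+ + 4 * d₁) eq)) (finish d₁ t)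
      where
      add-back : ∀ d₂ d₁ → d₂ ≡ (d₂ - + 4 * d₁) + + 4 * d₁
      add-back = solve-∀
      finish : ∀ d₁ t → (0ℤ - + 2 * t) + + 4 * d₁ ≡ + 4 * d₁ - + 2 * t
      finish = solve-∀
    collect : ∀ m t → + 4 * ((1ℤ + m) * t) - + 2 * t ≡ (+ 4 * m + + 2) * t
    collect = solve-∀

  -- (m + 1) · T(m + 1) = C(2m, m), by induction: both sides satisfy the same first-order
  -- recurrence, T-step and central-rec.
  T-central : ∀ m → + suc m * T (suc m) ≡ + central m
  T-central zero    = trans (*-identityˡ (T 1)) T1
  T-central (suc m) = *-cancelˡ-≡ (+ suc m) (+ suc (suc m) * T (suc (suc m))) (+ central (suc m)) (begin
      + suc m * (+ suc (suc m) * T (suc (suc m)))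
    ≡⟨ cong (+ suc m *_) (T-step m) ⟩
      + suc m * (+ (4 ℕ.* m ℕ.+ 2) * T (suc m))
    ≡⟨ *-comm-middle (+ suc m) (+ (4 ℕ.* m ℕ.+ 2)) (T (suc m)) ⟩
      + (4 ℕ.* m ℕ.+ 2) * (+ suc m * T (suc m))
    ≡⟨ cong (+ (4 ℕ.* m ℕ.+ 2) *_) (T-central m) ⟩
      + (4 ℕ.* m ℕ.+ 2) * + central m
    ≡⟨ sym (pos-* (4 ℕ.* m ℕ.+ 2) (central m)) ⟩
      + ((4 ℕ.* m ℕ.+ 2) ℕ.* central m)
    ≡⟨ cong +_ (sym (central-rec m)) ⟩
      + (suc m ℕ.* central (suc m))
    ≡⟨ pos-* (suc m) (central (suc m)) ⟩
      + suc m * + central (suc m)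
    ∎)
    where
    *-comm-middle : ∀ a b x → a * (b * x) ≡ b * (a * x)
    *-comm-middle = solve-∀

module Counting where

  open import Data.Nat using (ℕ; zero; suc; _+_; _∸_; _≤_; _<_; z≤n; s≤s)
  open import Data.Nat.Properties using (≡-irrelevant; ≤-irrelevant; m≤m+n; m+n∸m≡n; m+[n∸m]≡n; suc-injective; m∸n≢0⇒n<m; 1+n≢0; ∸-monoʳ-<; <⇒≤)
  open import Data.Integer as ℤ using (ℤ; +_; 0ℤ; 1ℤ)
  import Data.Integer.Properties as ℤ
  open import Data.Fin using (Fin)
  open import Data.Fin.Properties using (+↔⊎; *↔×; 1↔⊤; cantor-schröder-bernstein)
  open import Data.Product using (Σ; _×_; _,_; proj₁; proj₂)
  open import Data.Product.Function.NonDependent.Propositional using (_×-↔_)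
  open import Data.Product.Function.Dependent.Propositional using (Σ-↔)
  open import Data.Sum using (_⊎_; inj₁; inj₂; [_,_])
  open import Data.Sum.Function.Propositional using (_⊎-↔_)
  open import Data.Empty using (⊥-elim)
  open import Data.Unit using (⊤; tt)
  open import Function using (_∘_)
  open import Function.Bundles using (_↔_; mk↔ₛ′; Inverse; Injection)
  open import Function.Properties.Inverse using (↔-trans; ↔-sym; ↔-refl; ↔⇒↣)
  open import Relation.Nullary using (¬_)
  open import Relation.Binary.PropositionalEquality hiding ([_])

  open import Defs using (sumTo)
  open Convolution using (δ; conv; sumTo-shift)

  private variable
    A B : Set
    m n : ℕ

  count-unique : A ↔ Fin m → A ↔ Fin n → m ≡ n
  count-unique f g = cantor-schröder-bernstein (Injection.injective (↔⇒↣ h)) (Injection.injective (↔⇒↣ (↔-sym h)))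
    where h = ↔-trans (↔-sym f) g

  -- Counting generating-function coefficients is phrased with this notion, since the
  -- coefficients live in ℤ while cardinalities live in ℕ.
  CountedBy : Set → ℤ → Set
  CountedBy A k = Σ ℕ (λ m → (A ↔ Fin m) × (+ m ≡ k))

  counted : A ↔ Fin m → CountedBy A (+ m)
  counted f = _ , f , refl

  counted-unique : A ↔ Fin m → ∀ {k} → CountedBy A k → + m ≡ k
  counted-unique f (_ , g , eq) = trans (cong +_ (count-unique f g)) eq

  counted-≡ : ∀ {k l} → k ≡ l → CountedBy A k → CountedBy A l
  counted-≡ refl c = c

  counted-↔ : ∀ {k} → A ↔ B → CountedBy B k → CountedBy A k
  counted-↔ f (m , g , eq) = m , ↔-trans f g , eq

  counted-∅ : ¬ A → CountedBy A 0ℤ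
  counted-∅ ¬a = 0 , mk↔ₛ′ (⊥-elim ∘ ¬a) (λ ()) (λ ()) (⊥-elim ∘ ¬a) , refl

  counted-⊤ : CountedBy ⊤ 1ℤ
  counted-⊤ = 1 , ↔-sym 1↔⊤ , refl

  counted-⊎ : ∀ {k l} → CountedBy A k → CountedBy B l → CountedBy (A ⊎ B) (k ℤ.+ l)
  counted-⊎ (m , f , refl) (n , g , refl) = m + n , ↔-trans (f ⊎-↔ g) (↔-sym (+↔⊎ {m})) , ℤ.pos-+ m n

  counted-× : ∀ {k l} → CountedBy A k → CountedBy B l → CountedBy (A × B) (k ℤ.* l)
  counted-× (m , f , refl) (n , g , refl) = _ , ↔-trans (f ×-↔ g) (↔-sym (*↔× {m})) , ℤ.pos-* m n

  Σ≤ : ℕ → (ℕ → Set) → Set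
  Σ≤ n B = Σ ℕ (λ i → i ≤ n × B i)

  Σ≤-zero : ∀ {B} → Σ≤ 0 B ↔ B 0
  Σ≤-zero {B} = mk↔ₛ′ to (λ b → 0 , z≤n , b) (λ _ → refl) (λ { (zero , z≤n , b) → refl })
    where
    to : Σ≤ 0 B → B 0
    to (zero , z≤n , b) = b

  Σ≤-suc : ∀ {n B} → Σ≤ (suc n) B ↔ (B 0 ⊎ Σ≤ n (B ∘ suc))
  Σ≤-suc {n} {B} = mk↔ₛ′ to from to∘from from∘to
    where
    to : Σ≤ (suc n) B → B 0 ⊎ Σ≤ n (B ∘ suc)
    to (zero  , _         , b) = inj₁ b
    to (suc i , s≤s i≤n , b) = inj₂ (i , i≤n , b)
    from : B 0 ⊎ Σ≤ n (B ∘ suc) → Σ≤ (suc n) B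
    from (inj₁ b)             = 0 , z≤n , b
    from (inj₂ (i , i≤n , b)) = suc i , s≤s i≤n , b
    to∘from : ∀ x → to (from x) ≡ x
    to∘from (inj₁ _) = refl
    to∘from (inj₂ _) = refl
    from∘to : ∀ x → from (to x) ≡ x
    from∘to (zero  , z≤n     , _) = refl
    from∘to (suc _ , s≤s _ , _) = refl

  counted-Σ≤ : ∀ n {B : ℕ → Set} {f : ℕ → ℤ} → (∀ i → i ≤ n → CountedBy (B i) (f i)) → CountedBy (Σ≤ n B) (sumTo n f)
  counted-Σ≤ zero    c = counted-↔ Σ≤-zero (c 0 z≤n)
  counted-Σ≤ (suc n) {f = f} c = counted-≡ (sym (sumTo-shift n f))
    (counted-↔ Σ≤-suc (counted-⊎ (c 0 z≤n) (counted-Σ≤ n (λ i i≤n → c (suc i) (s≤s i≤n)))))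

  Fibre : {A : Set} → (A → ℕ) → ℕ → Set
  Fibre {A} w n = Σ A (λ x → w x ≡ n)

  _⊕_ : (A → ℕ) → (B → ℕ) → A × B → ℕ
  (wA ⊕ wB) p = wA (proj₁ p) + wB (proj₂ p)

  -- Equations between naturals are propositions, so logically equivalent ones are isomorphic.
  ≡-↔ : ∀ {a b c d : ℕ} → (a ≡ b → c ≡ d) → (c ≡ d → a ≡ b) → (a ≡ b) ↔ (c ≡ d)
  ≡-↔ f g = mk↔ₛ′ f g (λ _ → ≡-irrelevant _ _) (λ _ → ≡-irrelevant _ _)

  Fibre-↔ : ∀ {wA : A → ℕ} {wB : B → ℕ} (f : A ↔ B) → (∀ y → wA (Inverse.from f y) ≡ wB y) → Fibre wA n ↔ Fibre wB n
  Fibre-↔ {wA = wA} {wB} f pres = Σ-↔ f (λ {x} → ≡-↔ (trans (pres-to x)) (trans (sym (pres-to x))))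
    where
    pres-to : ∀ x → wB (Inverse.to f x) ≡ wA x
    pres-to x = trans (sym (pres (Inverse.to f x))) (cong wA (Inverse.strictlyInverseʳ f x))

  Fibre-⊎ : ∀ (wA : A → ℕ) (wB : B → ℕ) n → Fibre [ wA , wB ] n ↔ (Fibre wA n ⊎ Fibre wB n)
  Fibre-⊎ wA wB n = mk↔ₛ′ to from to∘from from∘to
    where
    to : Fibre [ wA , wB ] n → Fibre wA n ⊎ Fibre wB n
    to (inj₁ a , p) = inj₁ (a , p)
    to (inj₂ b , p) = inj₂ (b , p)
    from : Fibre wA n ⊎ Fibre wB n → Fibre [ wA , wB ] n
    from (inj₁ (a , p)) = inj₁ a , p
    from (inj₂ (b , p)) = inj₂ b , p
    to∘from : ∀ x → to (from x) ≡ x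
    to∘from (inj₁ _) = refl
    to∘from (inj₂ _) = refl
    from∘to : ∀ x → from (to x) ≡ x
    from∘to (inj₁ _ , _) = refl
    from∘to (inj₂ _ , _) = refl

  Fibre-× : ∀ (wA : A → ℕ) (wB : B → ℕ) n →
            Fibre (wA ⊕ wB) n ↔ Σ≤ n (λ i → Fibre wA i × Fibre wB (n ∸ i))
  Fibre-× wA wB n = mk↔ₛ′ to from to∘from from∘to
    where
    to : Fibre (wA ⊕ wB) n → Σ≤ n (λ i → Fibre wA i × Fibre wB (n ∸ i))
    to ((a , b) , p) = wA a , subst (wA a ≤_) p (m≤m+n (wA a) (wB b)) , (a , refl) ,
                       (b , trans (sym (m+n∸m≡n (wA a) (wB b))) (cong (_∸ wA a) p))
    from : Σ≤ n (λ i → Fibre wA i × Fibre wB (n ∸ i)) → Fibre (wA ⊕ wB) n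
    from (i , i≤n , (a , pa) , (b , pb)) = (a , b) , trans (cong₂ _+_ pa pb) (m+[n∸m]≡n i≤n)
    to∘from : ∀ x → to (from x) ≡ x
    to∘from (i , i≤n , (a , refl) , (b , pb)) =
      cong₂ (λ u v → (wA a , u , (a , refl) , (b , v))) (≤-irrelevant _ _) (≡-irrelevant _ _)
    from∘to : ∀ x → from (to x) ≡ x
    from∘to ((a , b) , p) = cong ((a , b) ,_) (≡-irrelevant _ _)

  Fibre-suc : ∀ (w : A → ℕ) n → Fibre (λ x → suc (w x)) (suc n) ↔ Fibre w n
  Fibre-suc w n = Σ-↔ ↔-refl (≡-↔ suc-injective (cong suc))

  counted-point : ∀ k n → CountedBy (Fibre {⊤} (λ _ → k) n) (δ k n)
  counted-point zero    zero    = counted-↔ (mk↔ₛ′ (λ _ → tt) (λ _ → tt , refl) (λ _ → refl) (λ { (tt , refl) → refl })) counted-⊤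
  counted-point zero    (suc n) = counted-∅ (λ { (_ , ()) })
  counted-point (suc k) zero    = counted-∅ (λ { (_ , ()) })
  counted-point (suc k) (suc n) = counted-↔ (Fibre-suc (λ _ → k) n) (counted-point k n)

  -- A convolution Σ_{i ≤ n} A i × B (n - i) whose families are empty in size 0 is
  -- counted by the convolution of the counts, which need only be known for sizes 0 < i < n.
  -- This is what makes the counts below go through by strong induction on n.
  counted-conv : ∀ {A B : ℕ → Set} {a b : ℕ → ℤ} n → ¬ A 0 → a 0 ≡ 0ℤ → ¬ B 0 → b 0 ≡ 0ℤ →
                 (∀ i → 0 < i → i < n → CountedBy (A i) (a i) × CountedBy (B i) (b i)) →
                 CountedBy (Σ≤ n (λ i → A i × B (n ∸ i))) (conv a b n)
  counted-conv {A} {B} {a} {b} n ¬A0 a0≡0 ¬B0 b0≡0 interior = counted-Σ≤ n term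
    where
    term : ∀ i → i ≤ n → CountedBy (A i × B (n ∸ i)) (a i ℤ.* b (n ∸ i))
    term zero _ = counted-≡ (sym (trans (cong (ℤ._* b n) a0≡0) (ℤ.*-zeroˡ (b n)))) (counted-∅ (¬A0 ∘ proj₁))
    term (suc j) _ with n ∸ suc j in eq
    ... | zero  = counted-≡ (sym (trans (cong (a (suc j) ℤ.*_) b0≡0) (ℤ.*-zeroʳ (a (suc j))))) (counted-∅ (¬B0 ∘ proj₂))
    ... | suc k = counted-× (proj₁ (interior (suc j) (s≤s z≤n) 1+j<n)) (proj₂ (interior (suc k) (s≤s z≤n) 1+k<n))
      where
      1+j<n : suc j < n
      1+j<n = m∸n≢0⇒n<m (λ e → 1+n≢0 (trans (sym eq) e))
      1+k<n : suc k < n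
      1+k<n = subst (_< n) eq (∸-monoʳ-< {n} (s≤s z≤n) (<⇒≤ 1+j<n))

module BranchDecomposition where

  open import Defs
  open Counting using (Fibre; _⊕_; Fibre-↔; Fibre-⊎)
  open import Data.Nat using (ℕ; suc; _+_)
  open import Data.Nat.Properties using (+-assoc; +-identityʳ; +-suc; ≡-irrelevant)
  open import Data.List using (List; []; _∷_; _∷ʳ_; initLast; _∷ʳ′_)
  open import Data.List.Properties using (∷ʳ-injective)
  open import Data.Product using (Σ; _×_; _,_; proj₁)
  open import Data.Sum using (_⊎_; inj₁; inj₂; [_,_])
  open import Data.Unit using (⊤; tt)
  open import Data.Empty using (⊥-elim)
  open import Function using (_∘_)
  open import Function.Bundles using (_↔_; mk↔ₛ′; Inverse)
  open import Relation.Nullary using (¬_)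
  open import Function.Properties.Inverse using (↔-trans)
  open import Relation.Binary.PropositionalEquality hiding ([_])
  open ≡-Reasoning

  private variable
    A B : Set

  injective-section-↔ : (from : B → A) (to : A → B) → (∀ a → from (to a) ≡ a) → (∀ {b b'} → from b ≡ from b' → b ≡ b') → A ↔ B
  injective-section-↔ from to from∘to from-injective = mk↔ₛ′ to from (λ b → from-injective (from∘to (from b))) from∘to

  firstChild : Tree ↔ (⊤ ⊎ (Tree × Tree))
  firstChild = mk↔ₛ′ to from to∘from from∘to
    where
    to : Tree → ⊤ ⊎ (Tree × Tree)
    to (node [])       = inj₁ tt
    to (node (c ∷ cs)) = inj₂ (c , node cs)
    from : ⊤ ⊎ (Tree × Tree) → Tree
    from (inj₁ tt)            = node []
    from (inj₂ (c , node cs)) = node (c ∷ cs)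
    to∘from : ∀ y → to (from y) ≡ y
    to∘from (inj₁ tt)            = refl
    to∘from (inj₂ (c , node cs)) = refl
    from∘to : ∀ τ → from (to τ) ≡ τ
    from∘to (node [])      = refl
    from∘to (node (_ ∷ _)) = refl

  pairSize : Tree × Tree → ℕ
  pairSize = size ⊕ size

  firstChild-size : ∀ y → size (Inverse.from firstChild y) ≡ [ (λ _ → 1) , pairSize ] y
  firstChild-size (inj₁ tt)            = refl
  firstChild-size (inj₂ (c , node cs)) = sym (+-suc (size c) (sizeL cs))

  _◂_ : Tree → Tree → Tree
  node cs ◂ b = node (cs ∷ʳ b)

  ◂-size : ∀ τ b → size (τ ◂ b) ≡ size τ + size b
  ◂-size (node cs) b = cong suc (sizeL-∷ʳ cs)
    where
    sizeL-∷ʳ : ∀ cs → sizeL (cs ∷ʳ b) ≡ sizeL cs + size b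
    sizeL-∷ʳ []       = +-identityʳ (size b)
    sizeL-∷ʳ (c ∷ cs) = trans (cong (size c +_) (sizeL-∷ʳ cs)) (sym (+-assoc (size c) (sizeL cs) (size b)))

  ◂-rdepth : ∀ τ b → rdepth (τ ◂ b) ≡ suc (rdepth b)
  ◂-rdepth (node [])       b = refl
  ◂-rdepth (node (c ∷ cs)) b = cong suc (rdepthLast-∷ʳ c cs)
    where
    rdepthLast-∷ʳ : ∀ c cs → rdepthLast c (cs ∷ʳ b) ≡ rdepth b
    rdepthLast-∷ʳ c []       = refl
    rdepthLast-∷ʳ c (d ∷ ds) = rdepthLast-∷ʳ d ds

  children : Tree → List Tree
  children (node cs) = cs

  ◂-injective : ∀ {τ b τ' b'} → τ ◂ b ≡ τ' ◂ b' → τ ≡ τ' × b ≡ b'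
  ◂-injective {node cs} {b} {node cs'} {b'} eq with ∷ʳ-injective cs cs' (cong children eq)
  ... | refl , refl = refl , refl

  leaf≢◂ : ∀ τ b → node [] ≢ τ ◂ b
  leaf≢◂ (node [])      b ()
  leaf≢◂ (node (_ ∷ _)) b ()

  -- Branches whose rightmost leaf is at odd distance from the root they hang from,
  -- i.e. trees whose rightmost path has even length.
  Good : Tree → Set
  Good c = Odd (branchDist c)

  Branch : Set
  Branch = Σ Tree Good

  branchSize : Branch → ℕ
  branchSize = size ∘ proj₁

  leafBranch : Branch
  leafBranch = node [] , refl

  Branch-≡ : ∀ {c c' g g'} → c ≡ c' → _≡_ {A = Branch} (c , g) (c' , g')
  Branch-≡ {g = g} {g'} refl = cong (_ ,_) (≡-irrelevant g g')

  -- Grafting twice lengthens the rightmost path by two, so it preserves goodness.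
  ◂◂-rdepth : ∀ x y e → rdepth (x ◂ (y ◂ e)) ≡ suc (suc (rdepth e))
  ◂◂-rdepth x y e = trans (◂-rdepth x (y ◂ e)) (cong suc (◂-rdepth y e))

  ¬good-◂leaf : ∀ τ → ¬ Good (τ ◂ node [])
  ¬good-◂leaf τ good = odd2 (subst (Odd ∘ suc) (◂-rdepth τ (node [])) good)
    where
    odd2 : ¬ Odd 2
    odd2 ()

  extend : Tree × Tree → Branch → Branch
  extend (x , y) (e , good) = x ◂ (y ◂ e) , subst (Odd ∘ suc) (sym (◂◂-rdepth x y e)) good

  extend-size : ∀ p e → branchSize (extend p e) ≡ pairSize p + branchSize e
  extend-size (x , y) (e , _) = begin
    size (x ◂ (y ◂ e))       ≡⟨ ◂-size x (y ◂ e) ⟩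
    size x + size (y ◂ e)    ≡⟨ cong (size x +_) (◂-size y e) ⟩
    size x + (size y + size e) ≡⟨ sym (+-assoc (size x) (size y) (size e)) ⟩
    size x + size y + size e ∎

  joinBranch : ⊤ ⊎ ((Tree × Tree) × Branch) → Branch
  joinBranch (inj₁ tt)      = leafBranch
  joinBranch (inj₂ (p , e)) = extend p e

  -- Cutting the last two steps of the rightmost path of a branch other than a leaf.
  splitBranch : Branch → ⊤ ⊎ ((Tree × Tree) × Branch)
  splitBranch (node cs , good) with initLast cs
  ... | [] = inj₁ tt
  ... | xs ∷ʳ′ node ds with initLast ds
  ...   | [] = ⊥-elim (¬good-◂leaf (node xs) good)
  ...   | ys ∷ʳ′ e = inj₂ ((node xs , node ys) , (e , subst (Odd ∘ suc) (◂◂-rdepth (node xs) (node ys) e) good))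

  joinBranch∘splitBranch : ∀ e → joinBranch (splitBranch e) ≡ e
  joinBranch∘splitBranch (node cs , good) with initLast cs
  ... | [] = Branch-≡ refl
  ... | xs ∷ʳ′ node ds with initLast ds
  ...   | [] = ⊥-elim (¬good-◂leaf (node xs) good)
  ...   | ys ∷ʳ′ e = Branch-≡ refl

  joinBranch-injective : ∀ {u v} → joinBranch u ≡ joinBranch v → u ≡ v
  joinBranch-injective {inj₁ tt}                    {inj₁ tt}                    _  = refl
  joinBranch-injective {inj₁ tt}                    {inj₂ ((x , y) , (e , _))}  eq = ⊥-elim (leaf≢◂ x (y ◂ e) (cong proj₁ eq))
  joinBranch-injective {inj₂ ((x , y) , (e , _))}  {inj₁ tt}                    eq = ⊥-elim (leaf≢◂ x (y ◂ e) (cong proj₁ (sym eq)))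
  joinBranch-injective {inj₂ ((x , y) , (e , g))}  {inj₂ ((x' , y') , (e' , g'))} eq
    with ◂-injective (cong proj₁ eq)
  ... | refl , eq₁ with ◂-injective eq₁
  ...   | refl , refl = cong (λ h → inj₂ ((x , y) , (e , h))) (≡-irrelevant g g')

  branchIso : Branch ↔ (⊤ ⊎ ((Tree × Tree) × Branch))
  branchIso = injective-section-↔ joinBranch splitBranch joinBranch∘splitBranch joinBranch-injective

  -- The weight h on branches may be any weight
  -- that is additive under extend (the size, or the size minus one).
  first-branch : ∀ {X : Set} (h : Branch → ℕ) (w : X → ℕ) → (∀ p e → h (extend p e) ≡ pairSize p + h e) → ∀ n →
    Fibre (h ⊕ w) n ↔ (Fibre (λ x → h leafBranch + w x) n ⊎ Fibre (pairSize ⊕ (h ⊕ w)) n)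
  first-branch {X} h w h-extend n = ↔-trans (Fibre-↔ iso pres) (Fibre-⊎ _ _ n)
    where
    iso : (Branch × X) ↔ (X ⊎ ((Tree × Tree) × (Branch × X)))
    iso = mk↔ₛ′ to from to∘from from∘to
      where
      distribute : ⊤ ⊎ ((Tree × Tree) × Branch) → X → X ⊎ ((Tree × Tree) × (Branch × X))
      distribute (inj₁ tt)      x = inj₁ x
      distribute (inj₂ (p , e)) x = inj₂ (p , e , x)
      to : Branch × X → X ⊎ ((Tree × Tree) × (Branch × X))
      to (e , x) = distribute (splitBranch e) x
      from : X ⊎ ((Tree × Tree) × (Branch × X)) → Branch × X
      from (inj₁ x)           = leafBranch , x
      from (inj₂ (p , e , x)) = extend p e , x
      from-distribute : ∀ u x → from (distribute u x) ≡ (joinBranch u , x)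
      from-distribute (inj₁ tt) x = refl
      from-distribute (inj₂ _)  x = refl
      to∘from : ∀ y → to (from y) ≡ y
      to∘from (inj₁ x)           = refl
      to∘from (inj₂ (p , e , x)) = cong (λ u → distribute u x) (Inverse.strictlyInverseˡ branchIso (inj₂ (p , e)))
      from∘to : ∀ q → from (to q) ≡ q
      from∘to (e , x) = trans (from-distribute (splitBranch e) x) (cong (_, x) (joinBranch∘splitBranch e))
    pres : ∀ y → (h ⊕ w) (Inverse.from iso y) ≡ [ (λ x → h leafBranch + w x) , pairSize ⊕ (h ⊕ w) ] y
    pres (inj₁ x)           = refl
    pres (inj₂ (p , e , x)) = trans (cong (_+ w x) (h-extend p e)) (+-assoc (pairSize p) (h e) (w x))

module CountingTrees
  (T : ℕ → ℤ) (T0 : T 0 ≡ 0ℤ)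
  (T-rec : ∀ n → T n ≡ δ 1 n ℤ.+ conv T T n)
  (T-cubic : ∀ m → T (ℕ.suc m) ≡ (δ 0 m ℤ.+ T m) ℤ.+ conv (conv T T) T (ℕ.suc m))
  where

  open import Defs
  open Counting
  open BranchDecomposition
  open import Data.Nat using (zero; suc; _+_; _∸_; _<_)
  open import Data.Nat.Properties using (≡-irrelevant; suc-injective; +-suc; n<1+n; m≢1+n+m; +-cancelʳ-≡)
  open import Data.Nat.Tactic.RingSolver using (solve-∀)
  open import Data.Nat.Induction using (<-rec)
  open import Data.Integer using (+_)
  import Data.Integer.Properties as ℤ
  open import Data.List using (List; []; _∷_; length)
  open import Data.List.Relation.Unary.All using (All; []; _∷_)
  open import Data.Fin using (Fin)
  open import Data.Product using (Σ; _×_; _,_; proj₁)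
  open import Data.Sum using (_⊎_; inj₁; inj₂; [_,_])
  open import Data.Sum.Function.Propositional using (_⊎-↔_)
  open import Data.Unit using (⊤; tt)
  open import Function using (_∘_)
  open import Function.Bundles using (_↔_; mk↔ₛ′; Inverse)
  open import Function.Properties.Inverse using (↔-trans; ↔-refl; ↔-sym)
  open import Relation.Nullary using (¬_)
  open import Relation.Binary.PropositionalEquality hiding ([_])

  T²0 : conv T T 0 ≡ 0ℤ
  T²0 = trans (cong (ℤ._* T 0) T0) (ℤ.*-zeroˡ (T 0))

  trees-counted : ∀ n → CountedBy (Fibre size n) (T n)
  trees-counted = <-rec _ step
    where
    no-empty-tree : ¬ Fibre size 0
    no-empty-tree (node _ , ())
    step : ∀ n → (∀ {m} → m < n → CountedBy (Fibre size m) (T m)) → CountedBy (Fibre size n) (T n)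
    step n smaller = counted-↔ decomposition (counted-≡ (sym (T-rec n))
      (counted-⊎ (counted-point 1 n) (counted-conv n no-empty-tree T0 no-empty-tree T0 (λ i _ i<n → smaller i<n , smaller i<n))))
      where
      decomposition : Fibre size n ↔ (Fibre {⊤} (λ _ → 1) n ⊎ Σ≤ n (λ i → Fibre size i × Fibre size (n ∸ i)))
      decomposition = ↔-trans (Fibre-↔ firstChild firstChild-size) (↔-trans (Fibre-⊎ _ pairSize n) (↔-refl ⊎-↔ Fibre-× size size n))

  no-empty-pair : ¬ Fibre pairSize 0
  no-empty-pair ((node _ , _) , ())

  pairs-counted : ∀ n → CountedBy (Fibre pairSize n) (conv T T n)
  pairs-counted n = counted-↔ (Fibre-× size size n)
    (counted-conv n (λ { (node _ , ()) }) T0 (λ { (node _ , ()) }) T0 (λ i _ _ → trees-counted i , trees-counted i))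

  -- The children of the root of a Catalan--Stanley tree: a sequence of branches.
  Forest : Set
  Forest = Σ (List Tree) (All Good)

  forestSize : Forest → ℕ
  forestSize = sizeL ∘ proj₁

  forestCons : Forest ↔ (⊤ ⊎ (Branch × Forest))
  forestCons = mk↔ₛ′ to from to∘from from∘to
    where
    to : Forest → ⊤ ⊎ (Branch × Forest)
    to ([]     , [])     = inj₁ tt
    to (c ∷ cs , g ∷ gs) = inj₂ ((c , g) , (cs , gs))
    from : ⊤ ⊎ (Branch × Forest) → Forest
    from (inj₁ tt)                    = [] , []
    from (inj₂ ((c , g) , (cs , gs))) = c ∷ cs , g ∷ gs
    to∘from : ∀ y → to (from y) ≡ y
    to∘from (inj₁ tt) = refl
    to∘from (inj₂ _)  = refl
    from∘to : ∀ f → from (to f) ≡ f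
    from∘to ([]    , [])    = refl
    from∘to (_ ∷ _ , _ ∷ _) = refl

  NonEmpty : ℕ → Set
  NonEmpty = Fibre (branchSize ⊕ forestSize)

  forest-split : ∀ n → Fibre forestSize n ↔ (Fibre {⊤} (λ _ → 0) n ⊎ NonEmpty n)
  forest-split n = ↔-trans (Fibre-↔ forestCons pres) (Fibre-⊎ _ _ n)
    where
    pres : ∀ y → forestSize (Inverse.from forestCons y) ≡ [ (λ _ → 0) , branchSize ⊕ forestSize ] y
    pres (inj₁ tt) = refl
    pres (inj₂ _)  = refl

  forests-from-nonempty : ∀ n → CountedBy (NonEmpty n) (T n) → CountedBy (Fibre forestSize n) (δ 0 n ℤ.+ T n)
  forests-from-nonempty n c = counted-↔ (forest-split n) (counted-⊎ (counted-point 0 n) c)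

  -- Nonempty forests of size n are counted by T n, because both satisfy X = z + zX + T²X.
  nonempty-forests-counted : ∀ n → CountedBy (NonEmpty n) (T n)
  nonempty-forests-counted = <-rec _ step
    where
    no-empty : ¬ NonEmpty 0
    no-empty (((node _ , _) , _) , ())
    step : ∀ n → (∀ {m} → m < n → CountedBy (NonEmpty m) (T m)) → CountedBy (NonEmpty n) (T n)
    step zero    _       = counted-≡ (sym T0) (counted-∅ no-empty)
    step (suc m) smaller = counted-↔ (first-branch branchSize forestSize extend-size (suc m)) (counted-≡ (sym (T-cubic m))
      (counted-⊎ (counted-↔ (Fibre-suc forestSize m) (forests-from-nonempty m (smaller (n<1+n m))))
                 (counted-↔ (Fibre-× pairSize _ (suc m))
                   (counted-conv (suc m) no-empty-pair T²0 no-empty T0 (λ i _ i<n → pairs-counted i , smaller i<n)))))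

  CS-counted : ∀ m → CountedBy (CSn (suc m)) (δ 0 m ℤ.+ T m)
  CS-counted m = counted-↔ rootChildren (forests-from-nonempty m (nonempty-forests-counted m))
    where
    rootChildren : CSn (suc m) ↔ Fibre forestSize m
    rootChildren = mk↔ₛ′ to from to∘from from∘to
      where
      to : CSn (suc m) → Fibre forestSize m
      to (node cs , good , sz) = (cs , good) , suc-injective sz
      from : Fibre forestSize m → CSn (suc m)
      from ((cs , good) , sz) = node cs , good , cong suc sz
      to∘from : ∀ f → to (from f) ≡ f
      to∘from (f , _) = cong (f ,_) (≡-irrelevant _ _)
      from∘to : ∀ τ → from (to τ) ≡ τ
      from∘to (node cs , good , _) = cong (λ p → node cs , good , p) (≡-irrelevant _ _)

  -- In the bivariate count each branch c contributes one rightmost leaf (marked by t)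
  -- and size c - 1 other nodes (marked by z).
  excess : Tree → ℕ
  excess (node ds) = sizeL ds

  excessL : List Tree → ℕ
  excessL []       = 0
  excessL (c ∷ cs) = excess c + excessL cs

  sizeL-excess : ∀ cs → sizeL cs ≡ excessL cs + length cs
  sizeL-excess []            = refl
  sizeL-excess (node ds ∷ cs) = trans (cong (λ k → suc (sizeL ds + k)) (sizeL-excess cs)) (regroup (sizeL ds) (excessL cs) (length cs))
    where
    regroup : ∀ a b c → suc (a + (b + c)) ≡ (a + b) + suc c
    regroup = solve-∀

  branchExcess : Branch → ℕ
  branchExcess = excess ∘ proj₁

  extend-excess : ∀ p e → branchExcess (extend p e) ≡ pairSize p + branchExcess e
  extend-excess p@(node _ , _) e@(node ds , _) = suc-injective (trans (extend-size p e) (+-suc (pairSize p) (sizeL ds)))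

  Forestᵇ : ℕ → Set
  Forestᵇ b = Σ (List Tree) (λ cs → All Good cs × length cs ≡ b)

  forestExcess : ∀ {b} → Forestᵇ b → ℕ
  forestExcess = excessL ∘ proj₁

  NonEmptyᵇ : ℕ → ℕ → Set
  NonEmptyᵇ b = Fibre (branchExcess ⊕ forestExcess {b})

  -- The root itself is one of the z-nodes, so a = 0 is impossible.
  no-CSab-zero : ∀ b → ¬ CSab 0 b
  no-CSab-zero b (node cs , _ , deg , sz) = m≢1+n+m b (begin
    b                                ≡⟨ sym sz ⟩
    suc (sizeL cs)                   ≡⟨ cong suc (sizeL-excess cs) ⟩
    suc (excessL cs + length cs)     ≡⟨ cong (λ k → suc (excessL cs + k)) deg ⟩
    suc (excessL cs + b)             ∎)
    where open ≡-Reasoning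

  rootChildrenᵇ : ∀ a b → CSab (suc a) b ↔ Fibre (forestExcess {b}) a
  rootChildrenᵇ a b = mk↔ₛ′ to from to∘from from∘to
    where
    to : CSab (suc a) b → Fibre (forestExcess {b}) a
    to (node cs , good , deg , sz) = (cs , good , deg) ,
      +-cancelʳ-≡ (length cs) (excessL cs) a (trans (sym (sizeL-excess cs)) (trans (suc-injective sz) (cong (λ k → a + k) (sym deg))))
    from : Fibre (forestExcess {b}) a → CSab (suc a) b
    from ((cs , good , deg) , w) = node cs , good , deg , cong suc (trans (sizeL-excess cs) (cong₂ _+_ w deg))
    to∘from : ∀ f → to (from f) ≡ f
    to∘from (f , _) = cong (f ,_) (≡-irrelevant _ _)
    from∘to : ∀ τ → from (to τ) ≡ τ
    from∘to (node cs , good , deg , _) = cong (λ p → node cs , good , deg , p) (≡-irrelevant _ _)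

  Forestᵇ-zero : Forestᵇ 0 ↔ ⊤
  Forestᵇ-zero = mk↔ₛ′ (λ _ → tt) (λ _ → [] , [] , refl) (λ _ → refl) (λ { ([] , [] , refl) → refl })

  Forestᵇ-suc : ∀ b → Forestᵇ (suc b) ↔ (Branch × Forestᵇ b)
  Forestᵇ-suc b = mk↔ₛ′ to from to∘from from∘to
    where
    to : Forestᵇ (suc b) → Branch × Forestᵇ b
    to (c ∷ cs , g ∷ gs , len) = (c , g) , (cs , gs , suc-injective len)
    from : Branch × Forestᵇ b → Forestᵇ (suc b)
    from ((c , g) , (cs , gs , len)) = c ∷ cs , g ∷ gs , cong suc len
    to∘from : ∀ y → to (from y) ≡ y
    to∘from (e , (cs , gs , _)) = cong (λ p → e , (cs , gs , p)) (≡-irrelevant _ _)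
    from∘to : ∀ f → from (to f) ≡ f
    from∘to (c ∷ cs , g ∷ gs , _) = cong (λ p → c ∷ cs , g ∷ gs , p) (≡-irrelevant _ _)

  nonemptyᵇ-CSab : ∀ b k → NonEmptyᵇ b k ↔ CSab (suc k) (suc b)
  nonemptyᵇ-CSab b k = ↔-sym (↔-trans (rootChildrenᵇ k (suc b)) (Fibre-↔ (Forestᵇ-suc b) (λ _ → refl)))

  module CoefficientsOfS (S : ℕ → ℕ → ℕ) (hS : ∀ a b → CSab a b ↔ Fin (S a b)) where

    S-zero : ∀ b → + S 0 b ≡ 0ℤ
    S-zero b = counted-unique (hS 0 b) (counted-∅ (no-CSab-zero b))

    S-childless : ∀ a → + S (suc a) 0 ≡ δ 0 a
    S-childless a = counted-unique (hS (suc a) 0)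
      (counted-↔ (↔-trans (rootChildrenᵇ a 0) (Fibre-↔ Forestᵇ-zero (λ _ → refl))) (counted-point 0 a))

    -- Removing the first branch of the root: it is a leaf, or a pair of trees grafted
    -- onto a shorter branch.  Hence  S(a+1, b+1) = S(a+1, b) + Σ_{j ≤ a} [zʲ]T² · S(a-j+1, b+1).
    S-rec : ∀ a b → + S (suc a) (suc b) ≡ + S (suc a) b ℤ.+ conv (conv T T) (λ k → + S (suc k) (suc b)) a
    S-rec a b = counted-unique (hS (suc a) (suc b)) (counted-↔ decomposition
      (counted-⊎ (counted (hS (suc a) b))
                 (counted-Σ≤ a (λ j _ → counted-× (pairs-counted j) (counted-↔ (nonemptyᵇ-CSab b (a ∸ j)) (counted (hS (suc (a ∸ j)) (suc b))))))))
      where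
      decomposition : CSab (suc a) (suc b) ↔ (CSab (suc a) b ⊎ Σ≤ a (λ j → Fibre pairSize j × NonEmptyᵇ b (a ∸ j)))
      decomposition = ↔-trans (rootChildrenᵇ a (suc b)) (↔-trans (Fibre-↔ (Forestᵇ-suc b) (λ _ → refl))
                      (↔-trans (first-branch branchExcess forestExcess extend-excess a) (↔-sym (rootChildrenᵇ a b) ⊎-↔ Fibre-× pairSize _ a)))

module BivariateSeries where

  open import Defs
  open Convolution
  open import Data.Nat as ℕ using (ℕ; zero; suc; _∸_; _≤_)
  import Data.Nat.Properties as ℕ
  open import Data.Integer using (+_; _+_; _*_; _-_)
  open import Data.Integer.Properties
  open import Relation.Nullary using (¬_)
  open import Relation.Binary.PropositionalEquality
  open ≡-Reasoning

  column : Series → ℕ → ℕ → ℤ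
  column F b a = F a b

  one-column : ∀ a → oneₛ a 0 ≡ δ 0 a
  one-column zero    = refl
  one-column (suc a) = refl

  z-column : ∀ a → zₛ a 0 ≡ δ 1 a
  z-column zero          = refl
  z-column (suc zero)    = refl
  z-column (suc (suc a)) = refl

  t-column-0 : ∀ a → tₛ a 0 ≡ 0ℤ
  t-column-0 zero    = refl
  t-column-0 (suc a) = refl

  t-column-1 : ∀ a → tₛ a 1 ≡ δ 0 a
  t-column-1 zero    = refl
  t-column-1 (suc a) = refl

  one-high : ∀ a k → oneₛ a (suc k) ≡ 0ℤ
  one-high zero    k = refl
  one-high (suc a) k = refl

  t-high : ∀ a k → tₛ a (suc (suc k)) ≡ 0ℤ
  t-high zero    k = refl
  t-high (suc a) k = refl

  square-coefficients : ∀ T → ((oneₛ -ₛ ((+ 2) ·ₛ liftZ T)) *ₛ (oneₛ -ₛ ((+ 2) ·ₛ liftZ T))) ≈ₛ (oneₛ -ₛ ((+ 4) ·ₛ zₛ)) →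
                        ∀ n → conv (λ i → δ 0 i - + 2 * T i) (λ i → δ 0 i - + 2 * T i) n ≡ δ 0 n - + 4 * δ 1 n
  square-coefficients T H n = begin
      conv R R n
    ≡⟨ conv-congˡ R (λ i → sym (R₀≡R i)) n ⟩
      conv R₀ R n
    ≡⟨ conv-congʳ R₀ (λ i → sym (R₀≡R i)) n ⟩
      conv R₀ R₀ n
    ≡⟨ H n 0 ⟩
      oneₛ n 0 - + 4 * zₛ n 0
    ≡⟨ cong₂ (λ x y → x - + 4 * y) (one-column n) (z-column n) ⟩
      δ 0 n - + 4 * δ 1 n
    ∎
    where
    R R₀ : ℕ → ℤ
    R  i = δ 0 i - + 2 * T i
    R₀ i = oneₛ i 0 - + 2 * T i
    R₀≡R : ∀ i → R₀ i ≡ R i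
    R₀≡R i = cong (_- + 2 * T i) (one-column i)

  liftZ-*ₛ-high : ∀ f g a k → (liftZ f *ₛ liftZ g) a (suc k) ≡ 0ℤ
  liftZ-*ₛ-high f g a k = sumTo-zero a (λ i _ → sumTo-zero (suc k) (λ
    { zero    _ → *-zeroʳ (f i)
    ; (suc j) _ → *-zeroˡ (liftZ g (a ∸ i) (suc k ∸ suc j)) }))

  *ₛ-column-suc : ∀ F G → (∀ a k → G a (suc (suc k)) ≡ 0ℤ) → ∀ a b →
                  (F *ₛ G) a (suc b) ≡ conv (column F b) (column G 1) a + conv (column F (suc b)) (column G 0) a
  *ₛ-column-suc F G G-high a b = trans (sumTo-cong a (λ i _ → two-terms i)) (sumTo-+ a _ _)
    where
    two-terms : ∀ i → sumTo (suc b) (λ j → F i j * G (a ∸ i) (suc b ∸ j)) ≡ F i b * G (a ∸ i) 1 + F i (suc b) * G (a ∸ i) 0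
    two-terms i = cong₂ _+_ (trans (sumTo-single b b ℕ.≤-refl vanishing) (cong (λ k → F i b * G (a ∸ i) k) (ℕ.m+n∸n≡m 1 b)))
                            (cong (λ k → F i (suc b) * G (a ∸ i) k) (ℕ.n∸n≡0 b))
      where
      vanishing : ∀ j → j ≤ b → ¬ j ≡ b → F i j * G (a ∸ i) (suc b ∸ j) ≡ 0ℤ
      vanishing j j≤b j≢b = trans (cong (λ k → F i j * G (a ∸ i) k) (trans (ℕ.+-∸-assoc 1 j≤b) (cong suc (ℕ.+-∸-assoc 1 (ℕ.≤∧≢⇒< j≤b j≢b)))))
                                  (trans (cong (F i j *_) (G-high (a ∸ i) (b ∸ suc j))) (*-zeroʳ (F i j)))

  zt-column-suc : ∀ a b → (zₛ *ₛ tₛ) a (suc b) ≡ zₛ a b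
  zt-column-suc a b = begin
      (zₛ *ₛ tₛ) a (suc b)
    ≡⟨ *ₛ-column-suc zₛ tₛ t-high a b ⟩
      conv (column zₛ b) (column tₛ 1) a + conv (column zₛ (suc b)) (column tₛ 0) a
    ≡⟨ cong₂ _+_ (trans (conv-congʳ (column zₛ b) t-column-1 a) (conv-oneʳ (column zₛ b) a)) (conv-zeroʳ (column zₛ (suc b)) t-column-0 a) ⟩
      zₛ a b + 0ℤ
    ≡⟨ +-identityʳ (zₛ a b) ⟩
      zₛ a b
    ∎

module SeriesIdentity
  (T : ℕ → ℤ) (S : ℕ → ℕ → ℕ)
  (S-zero : ∀ b → ℤ.+ S 0 b ≡ 0ℤ)
  (S-childless : ∀ a → ℤ.+ S (ℕ.suc a) 0 ≡ δ 0 a)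
  (S-rec : ∀ a b → ℤ.+ S (ℕ.suc a) (ℕ.suc b) ≡ ℤ.+ S (ℕ.suc a) b ℤ.+ conv (conv T T) (λ k → ℤ.+ S (ℕ.suc k) (ℕ.suc b)) a)
  where

  open import Defs
  open Convolution
  open BivariateSeries
  open import Data.Nat using (zero; suc)
  open import Data.Integer using (+_; 1ℤ; _+_; _*_; -_; _-_)
  open import Data.Integer.Properties
  open import Data.Integer.Tactic.RingSolver using (solve-∀)
  open import Relation.Binary.PropositionalEquality
  open ≡-Reasoning

  U : Series
  U = fromℕ S -ₛ zₛ

  G : Series
  G = (oneₛ -ₛ tₛ) -ₛ (liftZ T *ₛ liftZ T)

  U-column-0 : ∀ a → U a 0 ≡ 0ℤ
  U-column-0 zero          = cong (_- 0ℤ) (S-zero 0)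
  U-column-0 (suc zero)    = cong (_- 1ℤ) (S-childless 0)
  U-column-0 (suc (suc a)) = cong (_- 0ℤ) (S-childless (suc a))

  U-row-0 : ∀ b → U 0 b ≡ 0ℤ
  U-row-0 b = cong (_- 0ℤ) (S-zero b)

  U-suc : ∀ a b → U (suc a) (suc b) ≡ + S (suc a) (suc b)
  U-suc zero    b = +-identityʳ (+ S 1 (suc b))
  U-suc (suc a) b = +-identityʳ (+ S (suc (suc a)) (suc b))

  G-column-0 : ∀ a → G a 0 ≡ δ 0 a + - conv T T a
  G-column-0 a = trans (cong₂ (λ x y → (x - y) - conv T T a) (one-column a) (t-column-0 a))
                       (cong (_- conv T T a) (+-identityʳ (δ 0 a)))

  G-column-1 : ∀ a → G a 1 ≡ - δ 0 a
  G-column-1 a = begin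
    (oneₛ a 1 - tₛ a 1) - (liftZ T *ₛ liftZ T) a 1  ≡⟨ cong₂ (λ x y → (x - y) - (liftZ T *ₛ liftZ T) a 1) (one-high a 0) (t-column-1 a) ⟩
    (0ℤ - δ 0 a) - (liftZ T *ₛ liftZ T) a 1          ≡⟨ cong (λ x → (0ℤ - δ 0 a) - x) (liftZ-*ₛ-high T T a 0) ⟩
    (0ℤ - δ 0 a) - 0ℤ                                ≡⟨ simplify (δ 0 a) ⟩
    - δ 0 a                                          ∎
    where
    simplify : ∀ d → (0ℤ - d) - 0ℤ ≡ - d
    simplify = solve-∀

  G-high : ∀ a k → G a (suc (suc k)) ≡ 0ℤ
  G-high a k = trans (cong₂ (λ x y → (x - y) - (liftZ T *ₛ liftZ T) a (suc (suc k))) (one-high a (suc k)) (t-high a k))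
                     (cong (λ x → 0ℤ - x) (liftZ-*ₛ-high T T a (suc k)))

  column-rec : ∀ a b → - U a b + (U a (suc b) + - conv (column U (suc b)) (conv T T) a) ≡ zₛ a b
  column-rec zero    b = vanish (U 0 b) (U 0 (suc b)) (conv T T 0) (U-row-0 b) (U-row-0 (suc b))
    where
    vanish : ∀ u v q → u ≡ 0ℤ → v ≡ 0ℤ → - u + (v + - (v * q)) ≡ 0ℤ
    vanish _ _ q refl refl = trans (+-identityˡ _) (cong -_ (*-zeroˡ q))
  column-rec (suc a) b = begin
      - U (suc a) b + (U (suc a) (suc b) + - conv (column U (suc b)) (conv T T) (suc a))
    ≡⟨ cong₂ (λ x y → - U (suc a) b + (x + - y)) (trans (U-suc a b) (S-rec a b)) shifted ⟩
      - (+ S (suc a) b - zₛ (suc a) b) + ((+ S (suc a) b + σ) + - σ)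
    ≡⟨ cancel (+ S (suc a) b) (zₛ (suc a) b) σ ⟩
      zₛ (suc a) b
    ∎
    where
    σ = conv (conv T T) (λ k → + S (suc k) (suc b)) a
    shifted : conv (column U (suc b)) (conv T T) (suc a) ≡ σ
    shifted = begin
        conv (column U (suc b)) (conv T T) (suc a)
      ≡⟨ conv-suc (column U (suc b)) (conv T T) a ⟩
        U 0 (suc b) * conv T T (suc a) + conv (λ k → U (suc k) (suc b)) (conv T T) a
      ≡⟨ cong₂ _+_ (trans (cong (_* conv T T (suc a)) (U-row-0 (suc b))) (*-zeroˡ (conv T T (suc a)))) (conv-congˡ (conv T T) (λ k → U-suc k b) a) ⟩
        0ℤ + conv (λ k → + S (suc k) (suc b)) (conv T T) a
      ≡⟨ trans (+-identityˡ _) (conv-comm (λ k → + S (suc k) (suc b)) (conv T T) a) ⟩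
        σ
      ∎
    cancel : ∀ s z σ → - (s - z) + ((s + σ) + - σ) ≡ z
    cancel = solve-∀

  series-identity : (U *ₛ G) ≈ₛ (zₛ *ₛ tₛ)
  series-identity a zero    = trans (conv-zeroˡ (column G 0) U-column-0 a) (sym (conv-zeroʳ (column zₛ 0) t-column-0 a))
  series-identity a (suc b) = begin
      (U *ₛ G) a (suc b)
    ≡⟨ *ₛ-column-suc U G G-high a b ⟩
      conv (column U b) (column G 1) a + conv (column U (suc b)) (column G 0) a
    ≡⟨ cong₂ _+_ (conv-congʳ (column U b) G-column-1 a) (conv-congʳ (column U (suc b)) G-column-0 a) ⟩
      conv (column U b) (λ i → - δ 0 i) a + conv (column U (suc b)) (λ i → δ 0 i + - conv T T i) a
    ≡⟨ cong₂ _+_ (trans (conv-negʳ (column U b) (δ 0) a) (cong -_ (conv-oneʳ (column U b) a)))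
                 (trans (conv-+ʳ (column U (suc b)) (δ 0) (λ i → - conv T T i) a) (cong₂ _+_ (conv-oneʳ (column U (suc b)) a) (conv-negʳ (column U (suc b)) (conv T T) a))) ⟩
      - U a b + (U a (suc b) + - conv (column U (suc b)) (conv T T) a)
    ≡⟨ column-rec a b ⟩
      zₛ a b
    ≡⟨ sym (zt-column-suc a b) ⟩
      (zₛ *ₛ tₛ) a (suc b)
    ∎

open import Defs
open import Data.Nat using (ℕ; suc; _*_; _/_; _+_)
open import Data.Nat.Combinatorics using (_C_)
open import Data.Integer using (ℤ; +_; 0ℤ)
open import Data.Fin using (Fin)
open import Data.Product using (_×_)
open import Function.Bundles using (_↔_)
open import Relation.Binary.PropositionalEquality using (_≡_)

open import Data.Nat.DivMod using (m*n/n≡m)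
open import Data.Integer using (1ℤ)
import Data.Integer.Properties as ℤ
open import Data.Product using (_,_)
open import Relation.Binary.PropositionalEquality using (sym; trans; cong; module ≡-Reasoning)
open Counting using (counted-unique)
open CentralBinomial using (central)
open BivariateSeries using (square-coefficients)

mainTheorem1 : (T : ℕ → ℤ) → T 0 ≡ 0ℤ
    → ((oneₛ -ₛ ((+ 2) ·ₛ liftZ T)) *ₛ (oneₛ -ₛ ((+ 2) ·ₛ liftZ T))) ≈ₛ (oneₛ -ₛ ((+ 4) ·ₛ zₛ))
    → (S : ℕ → ℕ → ℕ) → (∀ a b → CSab a b ↔ Fin (S a b))
    → (c : ℕ → ℕ) → (∀ n → CSn n ↔ Fin (c n))
    → ((fromℕ S -ₛ zₛ) *ₛ ((oneₛ -ₛ tₛ) -ₛ (liftZ T *ₛ liftZ T))) ≈ₛ (zₛ *ₛ tₛ)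
      × c 1 ≡ 1
      × (∀ m → c (2 + m) ≡ ((2 * m) C m) / suc m)
mainTheorem1 T T0 H S hS c hc = series-identity , c-one , c-central
  where
  open SquareRootSeries T T0 (square-coefficients T H)
  open CountingTrees T T0 T-rec T-cubic
  open CoefficientsOfS S hS
  open SeriesIdentity T S S-zero S-childless S-rec

  c-suc : ∀ m → + c (suc m) ≡ δ 0 m ℤ.+ T m
  c-suc m = counted-unique (hc (suc m)) (CS-counted m)

  c-one : c 1 ≡ 1
  c-one = ℤ.+-injective (trans (c-suc 0) (cong (λ t → 1ℤ ℤ.+ t) T0))

  c-central : ∀ m → c (2 + m) ≡ central m / suc m
  c-central m = sym (trans (cong (_/ suc m) (sym scaled)) (m*n/n≡m (c (2 + m)) (suc m)))
    where
    scaled : c (2 + m) * suc m ≡ central m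
    scaled = ℤ.+-injective (begin
      + (c (2 + m) * suc m)            ≡⟨ ℤ.pos-* (c (2 + m)) (suc m) ⟩
      + c (2 + m) ℤ.* + suc m          ≡⟨ ℤ.*-comm (+ c (2 + m)) (+ suc m) ⟩
      + suc m ℤ.* + c (2 + m)          ≡⟨ cong (λ t → + suc m ℤ.* t) (trans (c-suc (suc m)) (ℤ.+-identityˡ (T (suc m)))) ⟩
      + suc m ℤ.* T (suc m)            ≡⟨ T-central m ⟩
      + central m                      ∎)
      where open ≡-Reasoning
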